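{- Let $q$ be a positive integer. The class of signed bi-graphs that are not $q$-colorable is closed under Operations (sb1), (sb2), (sb3), (sb4) and (sb5)$_q$. That is: if $(G,\sigma)$ is a signed bi-graph that is not $q$-colorable and $(G',\sigma')$ is obtained from $(G,\sigma)$ by one application of (sb1), (sb2), (sb4) or (sb5)$_q$, then $(G',\sigma')$ is not $q$-colorable; and if $(G_1,\sigma_1)$ and $(G_2,\sigma_2)$ are vertex-disjoint signed bi-graphs that are both not $q$-colorable and $(G,\sigma)$ is obtained from them by (sb3), then $(G,\sigma)$ is not $q$-colorable.
   Context: A bi-graph is a loopless multigraph with at most two edges between any two distinct vertices. A signed bi-graph $(G,\sigma)$ is a bi-graph $G$ together with a map $\sigma\colon E(G)\to\{1,-1\}$ such that any two parallel edges have distinct signs; an edge $e$ is positive if $\sigma(e)=1$ and negative otherwise. For distinct vertices $u,v$, $m(u,v)$ is the number of edges joining $u$ and $v$; $u,v$ are adjacent (neighbours) if $m(u,v)\ge 1$. For a positive integer $k$, a $k$-coloring of $(G,\sigma)$ is a map $c\colon V(G)\to\mathbb{Z}_k$ such that $c(v)\neq\sigma(e)c(w)$ for every edge $e$ with ends $v,w$ (where $-x$ is the additive inverse in $\mathbb{Z}_k$); $(G,\sigma)$ is $k$-colorable if it has a $k$-coloring. $(K_n,\pm)$ denotes the bi-complete signed bi-graph on $n$ vertices, i.e. every two distinct vertices are joined by exactly one positive and one negative edge. For an integer $k\ge 0$, a signed bi-graph is $k$-thin if it is obtained from some $(K_n,\pm)$ by deleting at most $k$ pairwise vertex-disjoint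 edges. Switching at a vertex $v$ replaces $\sigma(e)$ by $-\sigma(e)$ for every edge $e$ incident with $v$ and leaves other signs unchanged. The operations (for a positive integer parameter $p$ in (sb5)$_p$): (sb1) Add vertices or signed edges (the result remaining a signed bi-graph). (sb2) Identify two nonadjacent vertices. (sb3) Given two vertex-disjoint signed bi-graphs $(G_1,\sigma_1)$, $(G_2,\sigma_2)$, a vertex $v$ of $G_1$ and a positive edge $e$ of $G_2$ with ends $x,y$: split $v$ into two new vertices $v_1,v_2$ (each edge formerly incident with $v$ becomes incident with exactly one of $v_1,v_2$, keeping its other end and its sign), remove $e$, and identify $v_1$ with $x$ and $v_2$ with $y$. (sb4) Switch at a vertex. (sb5)$_p$ If $p$ is even, remove a vertex that has at most $p/2$ neighbours; if $p$ is odd, remove a negative edge whose ends are joined by no other edge, identify these two ends, and add signed edges so that the resulting signed bi-graph is $\frac{p-3}{2}$-thin. -}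

module Defs where

open import Data.Nat using (ℕ; zero; suc; _≤_; _+_; _*_)
open import Data.Fin using (Fin; zero; suc; opposite)
open import Data.Bool using (Bool; true; false; _∨_; if_then_else_)
open import Data.List using (List; length; map; allFin)
open import Data.Nat.ListAction using (sum)
open import Data.List.Membership.Propositional using (_∈_)
open import Data.List.Relation.Unary.All using (All)
open import Data.List.Relation.Unary.AllPairs using (AllPairs)
open import Data.Product using (Σ; ∃; ∃₂; _×_; _,_)
open import Data.Sum using (_⊎_)
open import Function.Bundles using (_⇔_)
open import Function.Definitions using (Injective)
open import Relation.Binary.PropositionalEquality using (_≡_; _≢_)
open import Relation.Nullary using (¬_)

data Sign : Set where
  pl mi : Sign

flip : Sign → Sign
flip pl = mi
flip mi = pl

-- additive inverse in Z_k, with Z_k represented by Fin k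
-- (-0 = 0 and -(j+1) = k-(j+1))
negZ : ∀ {k} → Fin k → Fin k
negZ zero    = zero
negZ (suc j) = suc (opposite j)

act : ∀ {k} → Sign → Fin k → Fin k
act pl x = x
act mi x = negZ x

-- Since parallel edges have distinct signs and there are at most two of them,
-- an edge is determined by its sign and its two (distinct) ends:
-- E s u v ≡ true  iff there is an edge of sign s joining u and v.

record SBG : Set where
  field
    n        : ℕ
    E        : Sign → Fin n → Fin n → Bool
    loopless : ∀ s u → E s u u ≡ false
    symm     : ∀ s u v → E s u v ≡ E s v u
open SBG public

adj : (G : SBG) → Fin (n G) → Fin (n G) → Bool
adj G u v = E G pl u v ∨ E G mi u v

nbrCount : (G : SBG) → Fin (n G) → ℕ
nbrCount G x = sum (map (λ w → if adj G x w then 1 else 0) (allFin (n G)))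

IsColoring : (k : ℕ) (G : SBG) → (Fin (n G) → Fin k) → Set
IsColoring k G c = ∀ s u v → E G s u v ≡ true → c u ≢ act s (c v)

Colorable : (k : ℕ) → SBG → Set
Colorable k G = Σ (Fin (n G) → Fin k) (IsColoring k G)

Surj : ∀ {a b} → (Fin a → Fin b) → Set
Surj {a} {b} f = ∀ (y : Fin b) → ∃ λ (x : Fin a) → f x ≡ y

Inj : ∀ {a b} → (Fin a → Fin b) → Set
Inj f = Injective _≡_ _≡_ f

IdentifiesExactly : ∀ {a b} → (Fin a → Fin b) → Fin a → Fin a → Set
IdentifiesExactly f u v =
  u ≢ v × f u ≡ f v × Surj f ×
  (∀ x y → f x ≡ f y → x ≡ y ⊎ ((x ≡ u × y ≡ v) ⊎ (x ≡ v × y ≡ u)))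

-- k-thin: obtained from (K_n, ±) by deleting at most k pairwise
-- vertex-disjoint edges. A deleted edge is recorded as (s , a , b).

DelEdge : ℕ → Set
DelEdge m = Sign × Fin m × Fin m

VDisjoint : ∀ {m} → DelEdge m → DelEdge m → Set
VDisjoint (_ , a , b) (_ , c , d) = a ≢ c × a ≢ d × b ≢ c × b ≢ d

Thin : ℕ → SBG → Set
Thin k G =
  Σ (List (DelEdge (n G))) λ L →
    length L ≤ k ×
    All (λ { (_ , a , b) → a ≢ b }) L ×
    AllPairs VDisjoint L ×
    (∀ s a b → a ≢ b →
      (E G s a b ≡ false ⇔ ((s , a , b) ∈ L ⊎ (s , b , a) ∈ L)))

-- (sb1) add vertices or signed edges: G embeds in G' as a subgraph.
Sb1 : SBG → SBG → Set
Sb1 G G' = Σ (Fin (n G) → Fin (n G')) λ f → Inj f ×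
  (∀ s u v → E G s u v ≡ true → E G' s (f u) (f v) ≡ true)

-- (sb2) identify two nonadjacent vertices u, v (the quotient map is φ).
-- Edges of G' are exactly the images of edges of G (parallel edges of the
-- same sign arising from the identification are merged).
Sb2 : SBG → SBG → Set
Sb2 G G' = Σ (Fin (n G)) λ u → Σ (Fin (n G)) λ v →
  Σ (Fin (n G) → Fin (n G')) λ φ →
    IdentifiesExactly φ u v ×
    adj G u v ≡ false ×
    (∀ s a b → (E G' s (φ a) (φ b) ≡ true ⇔
       (∃₂ λ a' b' → φ a' ≡ φ a × φ b' ≡ φ b × E G s a' b' ≡ true)))

-- (sb3) G is obtained from G1, G2 by splitting v ∈ V(G1) into v1, v2,
-- deleting the positive edge xy of G2 and identifying v1 = x, v2 = y.
-- χ embeds V(G1) - v, ψ embeds V(G2); side s w = true means the edge of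
-- sign s between v and w is moved to v1 (= x), false: to v2 (= y).
Sb3 : SBG → SBG → SBG → Set
Sb3 G1 G2 G =
  Σ (Fin (n G1)) λ v → Σ (Fin (n G2)) λ x → Σ (Fin (n G2)) λ y →
  Σ (Sign → Fin (n G1) → Bool) λ side →
  Σ (Fin (n G1) → Fin (n G)) λ χ → Σ (Fin (n G2) → Fin (n G)) λ ψ →
    E G2 pl x y ≡ true ×
    (∀ w w' → w ≢ v → w' ≢ v → χ w ≡ χ w' → w ≡ w') ×
    Inj ψ ×
    (∀ w z → w ≢ v → χ w ≢ ψ z) ×
    (∀ a → (∃ λ w → w ≢ v × χ w ≡ a) ⊎ (∃ λ z → ψ z ≡ a)) ×
    (∀ s w w' → w ≢ v → w' ≢ v → E G s (χ w) (χ w') ≡ E G1 s w w') ×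
    (∀ s z z' → (E G s (ψ z) (ψ z') ≡ true ⇔
       (E G2 s z z' ≡ true ×
        ¬ (s ≡ pl × ((z ≡ x × z' ≡ y) ⊎ (z ≡ y × z' ≡ x)))))) ×
    (∀ s w z → w ≢ v → (E G s (χ w) (ψ z) ≡ true ⇔
       (E G1 s v w ≡ true × z ≡ (if side s w then x else y))))

-- (sb4) switch at a vertex x (φ is a relabelling bijection).
switchSign : ∀ {m} → (Fin m → Bool) → Fin m → Fin m → Sign → Sign
switchSign isx u v s with isx u | isx v
... | true  | false = flip s
... | false | true  = flip s
... | _     | _     = s

Sb4 : SBG → SBG → Set
Sb4 G G' = Σ (Fin (n G)) λ x → Σ (Fin (n G) → Fin (n G')) λ φ →
  Inj φ × Surj φ ×
  Σ (Fin (n G) → Bool) λ isx → (∀ w → (isx w ≡ true ⇔ w ≡ x)) ×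
  (∀ s u v → E G' s (φ u) (φ v) ≡ E G (switchSign isx u v s) u v)

-- (sb5)_p, p = 2k even: remove a vertex x with at most k neighbours
-- (φ embeds V(G') onto V(G) - x, G' is the induced subgraph).
RemoveVertex : ℕ → SBG → SBG → Set
RemoveVertex k G G' = Σ (Fin (n G)) λ x →
  nbrCount G x ≤ k ×
  Σ (Fin (n G') → Fin (n G)) λ φ → Inj φ ×
  (∀ a → φ a ≢ x) × (∀ b → b ≢ x → ∃ λ a → φ a ≡ b) ×
  (∀ s a b → E G' s a b ≡ E G s (φ a) (φ b))

-- (sb5)_p, p = 2k+3 odd: remove a negative edge uv whose ends are joined
-- by no other edge, identify u and v, add signed edges so that the result
-- is k-thin  (k = (p-3)/2).
ContractNeg : ℕ → SBG → SBG → Set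
ContractNeg k G G' = Σ (Fin (n G)) λ u → Σ (Fin (n G)) λ v →
  Σ (Fin (n G) → Fin (n G')) λ φ →
    E G mi u v ≡ true × E G pl u v ≡ false ×
    IdentifiesExactly φ u v ×
    (∀ s a b → E G s a b ≡ true → φ a ≢ φ b → E G' s (φ a) (φ b) ≡ true) ×
    Thin k G'

-- for p = 1, (p-3)/2 < 0 and no signed bi-graph is (p-3)/2-thin, so the
-- odd case is vacuous.
Sb5 : ℕ → SBG → SBG → Set
Sb5 p G G' =
  (Σ ℕ λ k → p ≡ 2 * k × RemoveVertex k G G') ⊎
  (Σ ℕ λ k → p ≡ 2 * k + 3 × ContractNeg k G G')

-- Each operation except (sb3) turns a q-coloring of the result back into a
-- q-coloring of the original graph; for (sb3) a coloring of the result
-- restricts to one of the two parts, according to whether the ends x, y of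
-- the removed edge receive the same color or not.  Group the colors of Z_q
-- into classes {a, −a}.  For q = 2k there are k + 1 classes and the removed
-- vertex has at most k neighbours, so some class is avoided by all of them
-- and the vertex can be colored from it.  For q = 2k + 3 there are k + 1
-- nonzero classes and the contracted graph misses at most k edges; two
-- vertices whose colors share a class are joined by a missing edge, so some
-- nonzero class a contains the color of at most one vertex.  Exchanging the
-- classes {0} and {±a} then yields a coloring in which the contracted
-- vertex gets a color c ≠ 0, and since q is odd c ≠ −c, which is what the
-- contracted negative edge requires.
module Submission where

open import Defs
open import Data.Nat using (ℕ; zero; suc; _≤_; _<_; _+_; _*_; _∸_; z≤n; s≤s)
open import Data.Nat.Properties
  using (≤-trans; ≤-reflexive; ≤-antisym; ≤-pred; +-monoʳ-≤; +-monoˡ-≤;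
         +-cancelʳ-≤; +-cancelˡ-≤; +-suc; +-comm; +-identityʳ; m+[n∸m]≡n;
         m<m+n; m≤m+n; n≤1+n; even≢odd)
open import Data.Fin using (Fin; zero; suc; toℕ; inject≤; opposite; _≟_)
open import Data.Fin.Properties
  using (toℕ-injective; toℕ<n; toℕ-inject≤; inject≤-injective;
         opposite-prop; opposite-involutive; suc-injective; pigeonhole; ¬∀⟶∃¬;
         <⇒≢; any?)
open import Data.Bool using (Bool; true; false; if_then_else_)
import Data.Bool.Properties as Boolₚ
open import Data.List using (List; []; _∷_; length; map; allFin; filter; lookup)
open import Data.Nat.ListAction using (sum)
open import Data.List.Membership.Propositional using (_∈_; find; lose)
open import Data.List.Membership.Propositional.Properties using (∈-filter⁺; ∈-allFin)
open import Data.List.Relation.Unary.Any as Any using (Any)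
open import Data.List.Relation.Unary.Any.Properties using (lookup-index)
open import Data.Product using (∃; _×_; _,_; proj₁; proj₂)
open import Data.Sum using (_⊎_; inj₁; inj₂; [_,_]′)
open import Data.Empty using (⊥-elim)
open import Function.Base using (_∘_)
open import Function.Bundles using (Equivalence)
open import Function.Definitions using (Injective)
open import Relation.Binary.PropositionalEquality
open import Relation.Nullary using (¬_; Dec; yes; no; contradiction)
open import Relation.Nullary.Decidable using (_×-dec_)

open ≡-Reasoning

infixr 7 _·_
_·_ : Sign → Sign → Sign
pl · s = s
mi · s = flip s

negZ-involutive : ∀ {q} (a : Fin q) → negZ (negZ a) ≡ a
negZ-involutive zero    = refl
negZ-involutive (suc j) = cong suc (opposite-involutive j)

act-involutive : ∀ {q} s (a : Fin q) → act s (act s a) ≡ a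
act-involutive pl a = refl
act-involutive mi a = negZ-involutive a

act-· : ∀ {q} s t (a : Fin q) → act (s · t) a ≡ act s (act t a)
act-· pl t  a = refl
act-· mi pl a = refl
act-· mi mi a = sym (negZ-involutive a)

flip-involutive : ∀ s → flip (flip s) ≡ s
flip-involutive pl = refl
flip-involutive mi = refl

act-zero : ∀ {q} s → act {suc q} s zero ≡ zero
act-zero pl = refl
act-zero mi = refl

toℕ-negZ : ∀ {q} (j : Fin q) → toℕ (suc j) + toℕ (negZ (suc j)) ≡ suc q
toℕ-negZ {q} j = cong suc (begin
  toℕ j + suc (toℕ (opposite j))   ≡⟨ +-suc (toℕ j) _ ⟩
  suc (toℕ j) + toℕ (opposite j)   ≡⟨ cong (suc (toℕ j) +_) (opposite-prop j) ⟩
  suc (toℕ j) + (q ∸ suc (toℕ j)) ≡⟨ m+[n∸m]≡n (toℕ<n j) ⟩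
  q                                 ∎)

negZ-fixed⇒zero : ∀ {m} (a : Fin (suc (2 * m))) → a ≡ negZ a → a ≡ zero
negZ-fixed⇒zero zero _ = refl
negZ-fixed⇒zero {m} (suc j) a≡-a = contradiction twice-a (even≢odd (toℕ (suc j)) m)
  where
  twice-a : 2 * toℕ (suc j) ≡ suc (2 * m)
  twice-a = begin
    toℕ (suc j) + (toℕ (suc j) + 0) ≡⟨ cong (toℕ (suc j) +_) (+-identityʳ _) ⟩
    toℕ (suc j) + toℕ (suc j)       ≡⟨ cong (λ b → toℕ (suc j) + toℕ b) a≡-a ⟩
    toℕ (suc j) + toℕ (negZ (suc j)) ≡⟨ toℕ-negZ j ⟩
    suc (2 * m)                      ∎

infix 4 _≈±_
_≈±_ : ∀ {q} → Fin q → Fin q → Set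
a ≈± b = ∃ λ s → a ≡ act s b

act-sym : ∀ {q} s {a b : Fin q} → a ≡ act s b → b ≡ act s a
act-sym s {b = b} refl = sym (act-involutive s b)

≈±-sym : ∀ {q} {a b : Fin q} → a ≈± b → b ≈± a
≈±-sym (s , eq) = s , act-sym s eq

≈±-trans : ∀ {q} {a b c : Fin q} → a ≈± b → b ≈± c → a ≈± c
≈±-trans {c = c} (s , refl) (t , refl) = s · t , sym (act-· s t c)

≈±-zero : ∀ {q} {a : Fin (suc q)} → a ≈± zero → a ≡ zero
≈±-zero (s , refl) = act-zero s

_≈±?_ : ∀ {q} (a b : Fin q) → Dec (a ≈± b)
a ≈±? b with a ≟ b | a ≟ negZ b
... | yes a≡b | _        = yes (pl , a≡b)
... | no  _   | yes a≡-b = yes (mi , a≡-b)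
... | no  a≢b | no  a≢-b = no λ { (pl , e) → a≢b e ; (mi , e) → a≢-b e }

2K≤x+y⇒x≡y : ∀ {x y K} → x ≤ K → y ≤ K → K + K ≤ x + y → x ≡ y
2K≤x+y⇒x≡y {x} {y} {K} x≤K y≤K 2K≤x+y =
  trans (≤-antisym x≤K K≤x) (sym (≤-antisym y≤K K≤y))
  where
  K≤x : K ≤ x
  K≤x = +-cancelʳ-≤ K K x (≤-trans 2K≤x+y (+-monoʳ-≤ x y≤K))
  K≤y : K ≤ y
  K≤y = +-cancelˡ-≤ K K y (≤-trans 2K≤x+y (+-monoˡ-≤ y x≤K))

≈±-canonical : ∀ {q K} {a b : Fin q} → K + K ≤ q →
               toℕ a ≤ K → toℕ b ≤ K → a ≈± b → a ≡ b
≈±-canonical _ _ _ (pl , a≡b) = a≡b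
≈±-canonical {b = zero} _ _ _ (mi , a≡-b) = a≡-b
≈±-canonical {q = suc q} {b = suc j} 2K≤q a≤K b≤K (mi , refl) =
  toℕ-injective (2K≤x+y⇒x≡y a≤K b≤K (≤-trans 2K≤q
    (≤-reflexive (trans (sym (toℕ-negZ j)) (+-comm (toℕ (suc j)) _)))))

class : ∀ {K q} → K < q → Fin (suc K) → Fin q
class K<q i = inject≤ i K<q

class-≈±-injective : ∀ {K q} (K<q : K < q) → K + K ≤ q →
                     ∀ {i j} → class K<q i ≈± class K<q j → i ≡ j
class-≈±-injective K<q 2K≤q {i} {j} cls =
  inject≤-injective K<q K<q i j (≈±-canonical 2K≤q (bounded i) (bounded j) cls)
  where
  bounded : ∀ i → toℕ (class K<q i) ≤ _
  bounded i = ≤-trans (≤-reflexive (toℕ-inject≤ i K<q)) (≤-pred (toℕ<n i))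

∈-pigeonhole : ∀ {A : Set} {m} (xs : List A) → length xs < m →
               (f : Fin m → A) → (∀ i → f i ∈ xs) → ¬ Injective _≡_ _≡_ f
∈-pigeonhole xs len<m f f∈xs f-inj
  with i , j , i<j , same-index ← pigeonhole len<m (λ i → Any.index (f∈xs i)) =
  <⇒≢ i<j (f-inj (begin
    f i                                 ≡⟨ lookup-index (f∈xs i) ⟩
    lookup xs (Any.index (f∈xs i))      ≡⟨ cong (lookup xs) same-index ⟩
    lookup xs (Any.index (f∈xs j))      ≡⟨ lookup-index (f∈xs j) ⟨
    f j                                 ∎))

unwitnessed-index : ∀ {A : Set} {m} (xs : List A) (Q : A → Fin m → Set) →
  (∀ w i → Dec (Q w i)) → length xs < m →
  (∀ {w i j} → Q w i → Q w j → i ≡ j) →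
  ∃ λ i → ∀ {w} → w ∈ xs → ¬ Q w i
unwitnessed-index {m = m} xs Q Q? len<m Q-functional =
  let i , ¬witnessed = ¬∀⟶∃¬ m Witnessed (λ i → Any.any? (λ w → Q? w i) xs) all-witnessed
  in i , λ w∈xs Qwi → ¬witnessed (lose w∈xs Qwi)
  where
  Witnessed : Fin m → Set
  Witnessed i = Any (λ w → Q w i) xs
  all-witnessed : ¬ (∀ i → Witnessed i)
  all-witnessed witness = ∈-pigeonhole xs len<m (λ i → proj₁ (find (witness i)))
    (λ i → proj₁ (proj₂ (find (witness i))))
    (λ {i} {j} same → Q-functional (proj₂ (proj₂ (find (witness i))))
      (subst (λ w → Q w j) (sym same) (proj₂ (proj₂ (find (witness j))))))

length-filter-≡-count : ∀ {A : Set} (h : A → Bool) (xs : List A) →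
  length (filter (λ w → h w Boolₚ.≟ true) xs) ≡ sum (map (λ w → if h w then 1 else 0) xs)
length-filter-≡-count h [] = refl
length-filter-≡-count h (w ∷ xs) with h w
... | true  = cong suc (length-filter-≡-count h xs)
... | false = length-filter-≡-count h xs

edge⇒distinct : ∀ (G : SBG) {s u v} → E G s u v ≡ true → u ≢ v
edge⇒distinct G {s} {u} e refl with () ← trans (sym e) (loopless G s u)

edge⇒adj : ∀ (G : SBG) {s u v} → E G s u v ≡ true → adj G u v ≡ true
edge⇒adj G {pl} e rewrite e = refl
edge⇒adj G {mi} {u} {v} e rewrite e = Boolₚ.∨-zeroʳ (E G pl u v)

coloring⇒non-edge : ∀ {q} (G : SBG) {c} → IsColoring q G c →
                    ∀ {s u v} → c u ≡ act s (c v) → E G s u v ≡ false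
coloring⇒non-edge G c-ok {s} {u} {v} eq with E G s u v in e
... | true  = contradiction eq (c-ok s u v e)
... | false = refl

swapClass : ∀ {q} → Fin (suc q) → Fin (suc q) → Fin (suc q)
swapClass a x with x ≈±? a | x ≟ zero
... | yes _ | _     = zero
... | no _  | yes _ = a
... | no _  | no _  = x

swapClass-zero : ∀ {q} {a : Fin (suc q)} → a ≢ zero → swapClass a zero ≢ zero
swapClass-zero {q} {a} a≢0 with zero ≈±? a | zero {q} ≟ zero
... | yes 0≈±a | _      = λ _ → a≢0 (≈±-zero (≈±-sym 0≈±a))
... | no _     | yes _  = a≢0
... | no _     | no 0≢0 = contradiction refl 0≢0

swapClass-≡-act : ∀ {q} {a x y : Fin (suc q)} s → a ≢ zero →
  swapClass a x ≡ act s (swapClass a y) → x ≡ act s y ⊎ (x ≈± a × y ≈± a)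
swapClass-≡-act {a = a} {x} {y} s a≢0 eq
  with x ≈±? a | x ≟ zero | y ≈±? a | y ≟ zero
... | yes x≈a | _      | yes y≈a | _      = inj₂ (x≈a , y≈a)
... | yes _   | _      | no _    | yes _  = ⊥-elim (a≢0 (≈±-zero (≈±-sym (s , eq))))
... | yes _   | _      | no _    | no y≢0 = ⊥-elim (y≢0 (≈±-zero (≈±-sym (s , eq))))
... | no _    | yes _  | yes _   | _      = ⊥-elim (a≢0 (trans eq (act-zero s)))
... | no _    | yes x0 | no _    | yes y0 = inj₁ (trans x0 (sym (trans (cong (act s) y0) (act-zero s))))
... | no _    | yes _  | no y≉a  | no _   = ⊥-elim (y≉a (≈±-sym (s , eq)))
... | no _    | no x≢0 | yes _   | _      = ⊥-elim (x≢0 (trans eq (act-zero s)))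
... | no x≉a  | no _   | no _    | yes _  = ⊥-elim (x≉a (s , eq))
... | no _    | no _   | no _    | no _   = inj₁ eq

Sb1-reflects-Colorable : ∀ {q} G G' → Sb1 G G' → Colorable q G' → Colorable q G
Sb1-reflects-Colorable _ _ (f , _ , f-edges) (c , c-ok) =
  (λ u → c (f u)) , λ s u v e → c-ok s (f u) (f v) (f-edges s u v e)

Sb2-reflects-Colorable : ∀ {q} G G' → Sb2 G G' → Colorable q G' → Colorable q G
Sb2-reflects-Colorable _ _ (_ , _ , φ , _ , _ , φ-edges) (c , c-ok) =
  (λ a → c (φ a)) ,
  λ s a b e → c-ok s (φ a) (φ b) (Equivalence.from (φ-edges s a b) (a , b , refl , refl , e))

signOf : Bool → Sign
signOf true  = mi
signOf false = pl

switchSign-conj : ∀ {m} (isx : Fin m → Bool) u v s →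
  switchSign isx u v s ≡ signOf (isx u) · s · signOf (isx v)
switchSign-conj isx u v pl with isx u | isx v
... | true  | true  = refl
... | true  | false = refl
... | false | true  = refl
... | false | false = refl
switchSign-conj isx u v mi with isx u | isx v
... | true  | true  = refl
... | true  | false = refl
... | false | true  = refl
... | false | false = refl

switchSign-involutive : ∀ {m} (isx : Fin m → Bool) u v s →
  switchSign isx u v (switchSign isx u v s) ≡ s
switchSign-involutive isx u v s with isx u | isx v
... | true  | true  = refl
... | true  | false = flip-involutive s
... | false | true  = flip-involutive s
... | false | false = refl

Sb4-reflects-Colorable : ∀ {q} G G' → Sb4 G G' → Colorable q G' → Colorable q G
Sb4-reflects-Colorable {q} G G' (_ , φ , _ , _ , isx , _ , φ-edges) (c , c-ok) =
  col , col-ok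
  where
  τ : Fin (n G) → Sign
  τ w = signOf (isx w)
  col : Fin (n G) → Fin q
  col w = act (τ w) (c (φ w))
  col-ok : IsColoring q G col
  col-ok s u v e eq = c-ok s' (φ u) (φ v) e' c-eq
    where
    s' : Sign
    s' = switchSign isx u v s
    e' : E G' s' (φ u) (φ v) ≡ true
    e' = trans (φ-edges s' u v)
               (trans (cong (λ t → E G t u v) (switchSign-involutive isx u v s)) e)
    c-eq : c (φ u) ≡ act s' (c (φ v))
    c-eq = begin
      c (φ u)                                  ≡⟨ act-involutive (τ u) _ ⟨
      act (τ u) (col u)                        ≡⟨ cong (act (τ u)) eq ⟩
      act (τ u) (act s (act (τ v) (c (φ v))))  ≡⟨ cong (act (τ u)) (act-· s (τ v) _) ⟨
      act (τ u) (act (s · τ v) (c (φ v)))      ≡⟨ act-· (τ u) (s · τ v) _ ⟨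
      act (τ u · s · τ v) (c (φ v))            ≡⟨ cong (λ t → act t (c (φ v))) (switchSign-conj isx u v s) ⟨
      act s' (c (φ v))                         ∎

Sb3-restricts-Colorable : ∀ {q} G1 G2 G → Sb3 G1 G2 G → Colorable q G →
                          Colorable q G1 ⊎ Colorable q G2
Sb3-restricts-Colorable {q} G1 G2 G
  (v , x , y , side , χ , ψ , _ , _ , _ , _ , _ , χ-edges , ψ-edges , χψ-edges) (c , c-ok)
  with c (ψ x) ≟ c (ψ y)
... | no cx≢cy = inj₂ ((λ z → c (ψ z)) , G2-ok)
  where
  G2-ok : IsColoring q G2 (λ z → c (ψ z))
  G2-ok s z z' e eq = c-ok s (ψ z) (ψ z') (Equivalence.from (ψ-edges s z z') (e , not-xy)) eq
    where
    not-xy : ¬ (s ≡ pl × ((z ≡ x × z' ≡ y) ⊎ (z ≡ y × z' ≡ x)))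
    not-xy (refl , inj₁ (refl , refl)) = cx≢cy eq
    not-xy (refl , inj₂ (refl , refl)) = cx≢cy (sym eq)
... | yes cx≡cy = inj₁ (col , G1-ok)
  where
  col : Fin (n G1) → Fin q
  col w with w ≟ v
  ... | yes _ = c (ψ x)
  ... | no _  = c (χ w)
  c-side : ∀ b → c (ψ (if b then x else y)) ≡ c (ψ x)
  c-side true  = refl
  c-side false = sym cx≡cy
  v-edge : ∀ s w → w ≢ v → E G1 s v w ≡ true → c (χ w) ≢ act s (c (ψ x))
  v-edge s w w≢v e eq =
    c-ok s (χ w) (ψ z) (Equivalence.from (χψ-edges s w z w≢v) (e , refl))
         (trans eq (cong (act s) (sym (c-side (side s w)))))
    where
    z : Fin (n G2)
    z = if side s w then x else y
  G1-ok : IsColoring q G1 col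
  G1-ok s w w' e with w ≟ v | w' ≟ v
  ... | yes refl | yes refl = ⊥-elim (edge⇒distinct G1 e refl)
  ... | yes refl | no w'≢v  = λ eq → v-edge s w' w'≢v e (act-sym s eq)
  ... | no w≢v   | yes refl = v-edge s w w≢v (trans (symm G1 s v w) e)
  ... | no w≢v   | no w'≢v  = c-ok s (χ w) (χ w') (trans (χ-edges s w w' w≢v w'≢v) e)

RemoveVertex-reflects-Colorable : ∀ k G G' → RemoveVertex (suc k) G G' →
  Colorable (2 * suc k) G' → Colorable (2 * suc k) G
RemoveVertex-reflects-Colorable k G G'
  (x , deg≤ , φ , φ-inj , _ , φ-onto , φ-edges) (c , c-ok) = col , col-ok
  where
  K<q : suc k < 2 * suc k
  K<q = m<m+n (suc k) (s≤s z≤n)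
  2K≤q : suc k + suc k ≤ 2 * suc k
  2K≤q = ≤-reflexive (cong (suc k +_) (sym (+-identityʳ (suc k))))
  neighbours : List (Fin (n G))
  neighbours = filter (λ w → adj G x w Boolₚ.≟ true) (allFin (n G))
  few-neighbours : length neighbours < suc (suc k)
  few-neighbours = s≤s (≤-trans (≤-reflexive (length-filter-≡-count (adj G x) (allFin (n G)))) deg≤)
  ColoredIn : Fin (n G) → Fin (suc (suc k)) → Set
  ColoredIn w i = ∃ λ y → φ y ≡ w × c y ≈± class K<q i
  free : ∃ λ i → ∀ {w} → w ∈ neighbours → ¬ ColoredIn w i
  free = unwitnessed-index neighbours ColoredIn
    (λ w i → any? λ y → (φ y ≟ w) ×-dec (c y ≈±? class K<q i)) few-neighbours
    λ { (y , φy≡w , y≈i) (y' , φy'≡w , y'≈j) →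
        class-≈±-injective K<q 2K≤q
          (≈±-trans (≈±-sym y≈i) (subst (λ t → c t ≈± _) (sym (φ-inj (trans φy≡w (sym φy'≡w)))) y'≈j)) }
  a : Fin (2 * suc k)
  a = class K<q (proj₁ free)
  col : Fin (n G) → Fin (2 * suc k)
  col b with b ≟ x
  ... | yes _   = a
  ... | no b≢x  = c (proj₁ (φ-onto b b≢x))
  neighbour-avoids-a : ∀ {s b} y → φ y ≡ b → E G s x b ≡ true → ¬ c y ≈± a
  neighbour-avoids-a {b = b} y φy≡b e y≈a =
    proj₂ free (∈-filter⁺ (λ w → adj G x w Boolₚ.≟ true) (∈-allFin b) (edge⇒adj G e)) (y , φy≡b , y≈a)
  col-ok : IsColoring (2 * suc k) G col
  col-ok s b b' e with b ≟ x | b' ≟ x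
  ... | yes refl | yes refl = ⊥-elim (edge⇒distinct G e refl)
  ... | yes refl | no b'≢x  = λ eq →
    neighbour-avoids-a _ (proj₂ (φ-onto b' b'≢x)) e (≈±-sym (s , eq))
  ... | no b≢x   | yes refl = λ eq →
    neighbour-avoids-a _ (proj₂ (φ-onto b b≢x)) (trans (symm G s x b) e) (s , eq)
  ... | no b≢x   | no b'≢x
    with y , φy≡b ← φ-onto b b≢x | y' , φy'≡b' ← φ-onto b' b'≢x =
    c-ok s y y' (trans (φ-edges s y y') (trans (cong₂ (E G s) φy≡b φy'≡b') e))

nonzero-Coloring-at : ∀ k G → Thin k G → Colorable (suc (2 * suc k)) G →
  (w : Fin (n G)) → ∃ λ c → IsColoring (suc (2 * suc k)) G c × c w ≢ zero
nonzero-Coloring-at k G (L , |L|≤k , _ , _ , missing) (c , c-ok) w with c w ≟ zero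
... | no cw≢0 = c , c-ok , cw≢0
... | yes cw≡0 = (λ y → swapClass a (c y)) , swapped-ok ,
                 λ e → swapClass-zero a≢0 (subst (λ t → swapClass a t ≡ zero) cw≡0 e)
  where
  K<q : suc k < suc (2 * suc k)
  K<q = s≤s (m≤m+n (suc k) _)
  2K≤q : suc k + suc k ≤ suc (2 * suc k)
  2K≤q = ≤-trans (≤-reflexive (cong (suc k +_) (sym (+-identityʳ (suc k))))) (n≤1+n _)
  nonzero-class : Fin (suc k) → Fin (suc (2 * suc k))
  nonzero-class i = class K<q (suc i)
  ColoredIn : DelEdge (n G) → Fin (suc k) → Set
  ColoredIn (_ , y , _) i = c y ≈± nonzero-class i
  free : ∃ λ i → ∀ {d} → d ∈ L → ¬ ColoredIn d i
  free = unwitnessed-index L ColoredIn (λ (_ , y , _) i → c y ≈±? nonzero-class i) (s≤s |L|≤k)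
    λ y≈i y≈j → suc-injective (class-≈±-injective K<q 2K≤q (≈±-trans (≈±-sym y≈i) y≈j))
  a : Fin (suc (2 * suc k))
  a = nonzero-class (proj₁ free)
  a≢0 : a ≢ zero
  a≢0 a≡0 with () ← trans (sym (toℕ-inject≤ (suc (proj₁ free)) K<q)) (cong toℕ a≡0)
  -- two vertices colored from the class of a would span a missing edge
  lonely : ∀ {y z} → c y ≈± a → c z ≈± a → y ≡ z
  lonely {y} {z} y≈a z≈a with y ≟ z | ≈±-trans y≈a (≈±-sym z≈a)
  ... | yes y≡z | _ = y≡z
  ... | no y≢z  | s , cy≡scz with Equivalence.to (missing s y z y≢z) (coloring⇒non-edge G c-ok cy≡scz)
  ...   | inj₁ yz∈L = ⊥-elim (proj₂ free yz∈L y≈a)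
  ...   | inj₂ zy∈L = ⊥-elim (proj₂ free zy∈L z≈a)
  swapped-ok : IsColoring (suc (2 * suc k)) G (λ y → swapClass a (c y))
  swapped-ok s y z e eq with swapClass-≡-act s a≢0 eq
  ... | inj₁ cy≡scz        = c-ok s y z e cy≡scz
  ... | inj₂ (y≈a , z≈a)   = edge⇒distinct G e (lonely y≈a z≈a)

ContractNeg-reflects-Colorable : ∀ k G G' → ContractNeg k G G' →
  Colorable (suc (2 * suc k)) G' → Colorable (suc (2 * suc k)) G
ContractNeg-reflects-Colorable k G G'
  (u , v , φ , _ , no-pl , (_ , φu≡φv , _ , φ-fibres) , φ-edges , thin) col'
  with nonzero-Coloring-at k G' thin col' (φ u)
... | c , c-ok , cφu≢0 = (λ a → c (φ a)) , col-ok
  where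
  contracted : ∀ s {a b} → (a ≡ u × b ≡ v) ⊎ (a ≡ v × b ≡ u) → E G s a b ≡ true →
               c (φ a) ≢ act s (c (φ b))
  contracted pl (inj₁ (refl , refl)) e _ with () ← trans (sym e) no-pl
  contracted pl (inj₂ (refl , refl)) e _ with () ← trans (sym e) (trans (symm G pl v u) no-pl)
  contracted mi (inj₁ (refl , refl)) _ eq =
    cφu≢0 (negZ-fixed⇒zero {suc k} _ (trans eq (cong (λ t → negZ (c t)) (sym φu≡φv))))
  contracted mi (inj₂ (refl , refl)) _ eq =
    cφu≢0 (negZ-fixed⇒zero {suc k} _ (trans (cong c φu≡φv) eq))
  col-ok : IsColoring (suc (2 * suc k)) G (λ a → c (φ a))
  col-ok s a b e with φ a ≟ φ b
  ... | no φa≢φb = c-ok s (φ a) (φ b) (φ-edges s a b e φa≢φb)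
  ... | yes φa≡φb with φ-fibres a b φa≡φb
  ...   | inj₁ a≡b  = ⊥-elim (edge⇒distinct G e a≡b)
  ...   | inj₂ ends = contracted s ends e

odd-form : ∀ k → 2 * k + 3 ≡ suc (2 * suc k)
odd-form k = trans (+-comm (2 * k) 3) (cong (λ m → suc (suc m)) (sym (+-suc k (k + 0))))

Sb5-reflects-Colorable : ∀ {p} G G' → 1 ≤ p → Sb5 p G G' → Colorable p G' → Colorable p G
Sb5-reflects-Colorable _ _ () (inj₁ (zero , refl , _))
Sb5-reflects-Colorable G G' _ (inj₁ (suc k , refl , rv)) = RemoveVertex-reflects-Colorable k G G' rv
Sb5-reflects-Colorable G G' _ (inj₂ (k , refl , cn)) =
  subst (λ q → Colorable q G' → Colorable q G) (sym (odd-form k))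
        (ContractNeg-reflects-Colorable k G G' cn)

theorem2p1 : (q : ℕ) → 1 ≤ q →
    ((G G' : SBG) → ¬ Colorable q G →
      (Sb1 G G' ⊎ Sb2 G G' ⊎ Sb4 G G' ⊎ Sb5 q G G') → ¬ Colorable q G')
    ×
    ((G1 G2 G : SBG) → ¬ Colorable q G1 → ¬ Colorable q G2 →
      Sb3 G1 G2 G → ¬ Colorable q G)
theorem2p1 q 1≤q =
  (λ G G' ¬col op → ¬col ∘ reflects G G' op) ,
  (λ G1 G2 G ¬col₁ ¬col₂ op → [ ¬col₁ , ¬col₂ ]′ ∘ Sb3-restricts-Colorable G1 G2 G op)
  where
  reflects : ∀ G G' → Sb1 G G' ⊎ Sb2 G G' ⊎ Sb4 G G' ⊎ Sb5 q G G' →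
             Colorable q G' → Colorable q G
  reflects G G' = [ Sb1-reflects-Colorable G G' ,
                  [ Sb2-reflects-Colorable G G' ,
                  [ Sb4-reflects-Colorable G G' , Sb5-reflects-Colorable G G' 1≤q ]′ ]′ ]′
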